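{- For $n,m\in\mathbb N$ and $i\in I_{nm}$ we have $h_n\big(\sigma_{m,n}(i)\big)=\sigma_{m,n}\big(h_{nm}(i)\big)$.
   Context: $\Gamma_0(N)=\{\begin{pmatrix}a&b\\c&d\end{pmatrix}\in SL(2,\mathbb Z):N\mid c\}$. $[x:y]_N$ denotes the class of $(x,y)\in\mathbb Z^2$ under $(x,y)\sim(x',y')$ iff $x'\equiv kx$, $y'\equiv ky \pmod N$ for some $k$ with $\gcd(k,N)=1$; $I_N=\{[x:y]_N:\gcd(x,y,N)=1\}$, identified with the right cosets $\Gamma_0(N)\backslash SL(2,\mathbb Z)$ via $\Gamma_0(N)\begin{pmatrix}a&b\\c&d\end{pmatrix}\mapsto[c:d]_N$. $\sigma_{m,n}:I_{nm}\to I_n$ is $[x:y]_{nm}\mapsto[x:y]_n$ (i.e. $\Gamma_0(nm)g\mapsto\Gamma_0(n)g$). $P_N=\{(c,b):c\ge1,c\mid N,0\le b\le N/c-1,\gcd(c,b,N/c)=1\}$ is in bijection with $I_N$ via $(c,b)\mapsto[c:d_N(c,b)]_N$, $d_N(c,b)=\min_{0\le k\le c-1}\{c+b+kN/c:\gcd(c,b+kN/c)=1\}$, and $A_i=\begin{pmatrix}c&b\\0&N/c\end{pmatrix}$ for $i\leftrightarrow(c,b)$. For $i\in I_N$ pick $R_i\in SL(2,\mathbb Z)$ in the coset $i$; $h_N(i)\in I_N$ is the unique index $l$ with $\begin{pmatrix}0&1\\-N&0\end{pmatrix}R_i\in SL(2,\mathbb Z)A_l$ (this is independent of the choice of $R_i$,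 and $h_N:I_N\to I_N$ is a bijection). -}

module Defs where

open import Data.Nat as ℕ using (ℕ; zero; suc; _≤_; _<_; _⊓_)
open import Data.Nat.GCD using (gcd)
open import Data.Integer as ℤ using (ℤ; +_; _-_; ∣_∣)
open import Data.Integer.Divisibility using () renaming (_∣_ to _∣ℤ_)
open import Data.List using (List; []; _∷_; foldr; map; filter; upTo)
open import Data.Product using (Σ; ∃; _×_; _,_)
open import Relation.Binary.PropositionalEquality using (_≡_)
open import Data.Nat using (_≟_)

record M2 : Set where
  constructor mat
  field
    a₁₁ a₁₂ a₂₁ a₂₂ : ℤ
open M2 public

_·_ : M2 → M2 → M2
mat a b c d · mat a' b' c' d' =
  mat (a ℤ.* a' ℤ.+ b ℤ.* c') (a ℤ.* b' ℤ.+ b ℤ.* d')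
      (c ℤ.* a' ℤ.+ d ℤ.* c') (c ℤ.* b' ℤ.+ d ℤ.* d')

det : M2 → ℤ
det (mat a b c d) = a ℤ.* d - b ℤ.* c

InSL2 : M2 → Set
InSL2 g = det g ≡ + 1

W : ℕ → M2
W N = mat (+ 0) (+ 1) (ℤ.- (+ N)) (+ 0)

-- [x:y]_N classes, represented by pairs (x , y) : ℤ × ℤ up to ~N

Pair : Set
Pair = ℤ × ℤ

_≡_[mod_] : ℤ → ℤ → ℕ → Set
a ≡ b [mod N ] = (+ N) ∣ℤ (a - b)

_∼[_]_ : Pair → ℕ → Pair → Set
(x , y) ∼[ N ] (x' , y') =
  ∃ λ (k : ℤ) → (gcd ∣ k ∣ N ≡ 1) × (x' ≡ k ℤ.* x [mod N ]) × (y' ≡ k ℤ.* y [mod N ])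

InI : ℕ → Pair → Set
InI N (x , y) = gcd (gcd ∣ x ∣ ∣ y ∣) N ≡ 1

-- coset Γ₀(N) R ↦ [c:d]_N  (bottom row of R)
bottomRow : M2 → Pair
bottomRow g = (a₂₁ g , a₂₂ g)

-- P_N : pairs (c,b) with c ≥ 1, c ∣ N, 0 ≤ b ≤ N/c - 1, gcd(c,b,N/c) = 1.
-- The divisibility c ∣ N is recorded by the cofactor q = N/c with c * q ≡ N.

record PN (N : ℕ) : Set where
  constructor pn
  field
    c q b  : ℕ
    c≥1    : 1 ≤ c
    cq≡N   : c ℕ.* q ≡ N
    b<q    : b < q
    coprim : gcd (gcd c b) q ≡ 1
open PN public

-- minimum of a list of naturals (0 for the empty list; never used on [] for P_N)
minList : List ℕ → ℕ
minList []       = 0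
minList (x ∷ xs) = foldr _⊓_ x xs

dN : ∀ {N} → PN N → ℕ
dN p = minList (map (λ k → c p ℕ.+ b p ℕ.+ k ℕ.* q p)
                    (filter (λ k → gcd (c p) (b p ℕ.+ k ℕ.* q p) ≟ 1) (upTo (c p))))

pnClass : ∀ {N} → PN N → Pair
pnClass p = (+ c p , + dN p)

A : ∀ {N} → PN N → M2
A p = mat (+ c p) (+ b p) (+ 0) (+ q p)

-- graph of h_N:  Hgraph N i l  ⇔  h_N(i) = l  (i, l given by representatives).
-- l = h_N(i) iff for some R ∈ SL(2,ℤ) in the coset i, and the element
-- (c,b) ∈ P_N corresponding to l, we have W_N R ∈ SL(2,ℤ) A_(c,b).

Hgraph : ℕ → Pair → Pair → Set
Hgraph N i l =
  Σ M2 λ R → InSL2 R × (bottomRow R ∼[ N ] i) ×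
  Σ (PN N) λ p → (pnClass p ∼[ N ] l) ×
  Σ M2 λ γ → InSL2 γ × (W N · R ≡ γ · A p)

-- Let A_p = (c b ; 0 q) be the matrix with W_{nm} R = γ A_p, so that p ↔ h_{nm}(i).
-- For g = gcd(c, n) one has A_p = δ A_{p′} with δ upper triangular and p′ = (g, b′) ∈ P_n,
-- where (c/g) b′ ≡ b mod n/g. The top row of W_N R is the bottom row of R whatever N is,
-- so it equals the top row of (γ δ) A_{p′}; since det R = 1, that top row of γ δ extends to
-- γ′ ∈ SL(2,ℤ) with W_n R = γ′ A_{p′}, i.e. h_n(σ(i)) ↔ p′. Finally the pairs
-- [c : d_{nm}(c,b)] and [g : d_n(g,b′)] consist of coprime integers and their cross product
-- is divisible by n, so they are the same point of I_n.

module Submission where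

open import Defs

open import Data.Nat as ℕ using (ℕ; _≤_; _<_; _≟_; NonZero)
import Data.Nat.Properties as ℕ
open import Data.Nat.Divisibility
  using (_∣_; divides; _∣0; ∣-trans; ∣m+n∣m⇒∣n; ∣m∣n⇒∣m+n; ∣m⇒∣m*n; m∣m*n; ∣1⇒≡1;
         quotient; quotient-∣; quotient-<; quotient≢0)
open import Data.Nat.DivMod using (_%_; _/_; m≡m%n+[m/n]*n; m%n<n; m/n*n≡m)
open import Data.Nat.GCD
  using (gcd; module Bézout; gcd[m,n]∣m; gcd[m,n]∣n; gcd-greatest; gcd[m,n]≡0⇒m≡0; n/gcd[m,n]≢0)
open import Data.Nat.Coprimality
  using (Coprime; coprime-divisor; coprime-Bézout; coprime-/gcd; gcd≡1⇒coprime; coprime⇒gcd≡1)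
import Data.Nat.Coprimality as Coprime
open import Data.Nat.Induction using (<-wellFounded)
import Data.Nat.Tactic.RingSolver as ℕ-Solver
open import Induction.WellFounded using (Acc; acc)
open import Data.Integer as ℤ using (ℤ; +_; -_; _+_; _-_; _*_; ∣_∣; 1ℤ)
import Data.Integer.Properties as ℤ
import Data.Integer.Coprimality as ℤ
open import Data.Integer.Divisibility.Signed as Signed using () renaming (_∣_ to _∣ℤ_)
open import Data.Integer.Tactic.RingSolver using (solve-∀)
open import Data.List using (List; _∷_; upTo)
open import Data.List.Membership.Propositional using (_∈_)
open import Data.List.Membership.Propositional.Properties
  using (foldr-selective; ∈-map⁺; ∈-map⁻; ∈-filter⁺; ∈-filter⁻; ∈-upTo⁺)
open import Data.List.Relation.Unary.Any using (here; there)
open import Data.Sum using (inj₁; inj₂)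
open import Data.Integer.DivMod using (_%ℕ_; _/ℕ_; a≡a%ℕn+[a/ℕn]*n; n%ℕd<d)
open import Data.Product using (Σ; ∃; ∃₂; _×_; _,_; proj₁; proj₂)
open import Function using (_∘_)
open import Relation.Nullary using (yes; no)
open import Relation.Binary.PropositionalEquality
open ≡-Reasoning

coprime-+* : ∀ {m a} k → Coprime m a → Coprime m (a ℕ.+ m ℕ.* k)
coprime-+* {m} {a} k cop {d} (d∣m , d∣a+mk) =
  cop (d∣m , ∣m+n∣m⇒∣n (subst (d ∣_) (ℕ.+-comm a (m ℕ.* k)) d∣a+mk) (∣m⇒∣m*n k d∣m))

coprime-+*⁻ : ∀ {m a} k → Coprime m (a ℕ.+ m ℕ.* k) → Coprime m a
coprime-+*⁻ k cop (d∣m , d∣a) = cop (d∣m , ∣m∣n⇒∣m+n d∣a (∣m⇒∣m*n k d∣m))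

coprime-∣ʳ : ∀ {a m n} → n ∣ m → Coprime a m → Coprime a n
coprime-∣ʳ n∣m cop (d∣a , d∣n) = cop (d∣a , ∣-trans d∣n n∣m)

coprime-*ʳ : ∀ {a m n} → Coprime a m → Coprime a n → Coprime a (m ℕ.* n)
coprime-*ʳ {m = m} copm copn {d} (d∣a , d∣mn) = copn (d∣a , coprime-divisor d⊥m d∣mn)
  where
  d⊥m : Coprime d m
  d⊥m (e∣d , e∣m) = copm (∣-trans e∣d d∣a , e∣m)

-- s collects the prime factors of c that do not divide b.
coprime-part : ∀ c b .{{_ : NonZero c}} →
               ∃ λ s → Coprime s b × (∀ {x} → Coprime x s → Coprime x (gcd c b) → Coprime x c)
coprime-part c b = go c (<-wellFounded c)
  where
  go : ∀ c → Acc _<_ c → .{{NonZero c}} →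
       ∃ λ s → Coprime s b × (∀ {x} → Coprime x s → Coprime x (gcd c b) → Coprime x c)
  go c (acc rec) with gcd c b ≟ 1
  ... | yes h≡1 = c , gcd≡1⇒coprime h≡1 , λ x⊥c _ → x⊥c
  ... | no h≢1 = s , s⊥b , x⊥c
    where
    h = gcd c b
    h∣c = gcd[m,n]∣m c b
    c′ = quotient h∣c
    instance
      h-nonTrivial : ℕ.NonTrivial h
      h-nonTrivial = ℕ.n>1⇒nonTrivial
        (ℕ.≤∧≢⇒< (ℕ.n≢0⇒n>0 (ℕ.≢-nonZero⁻¹ c ∘ gcd[m,n]≡0⇒m≡0)) (h≢1 ∘ sym))
      c′-nonZero : NonZero c′
      c′-nonZero = quotient≢0 h∣c
    ih = go c′ (rec (quotient-< h∣c))
    s = proj₁ ih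
    s⊥b = proj₁ (proj₂ ih)
    gcd[c′,b]∣h : gcd c′ b ∣ h
    gcd[c′,b]∣h = gcd-greatest (∣-trans (gcd[m,n]∣m c′ b) (quotient-∣ h∣c)) (gcd[m,n]∣n c′ b)
    x⊥c : ∀ {x} → Coprime x s → Coprime x h → Coprime x c
    x⊥c {x} x⊥s x⊥h = subst (Coprime x) (sym (_∣_.equality h∣c))
      (coprime-*ʳ (proj₂ (proj₂ ih) x⊥s (coprime-∣ʳ gcd[c′,b]∣h x⊥h)) x⊥h)

coprime-shift : ∀ c b q .{{_ : NonZero c}} → Coprime (gcd c b) q →
                ∃ λ k → k < c × Coprime c (b ℕ.+ k ℕ.* q)
coprime-shift c b q h⊥q with coprime-part c b
... | s , s⊥b , ⊥c = s % c , m%n<n s c , coprime-+*⁻ (s / c ℕ.* q) (subst (Coprime c) split c⊥B)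
  where
  B = b ℕ.+ s ℕ.* q
  B⊥s : Coprime B s
  B⊥s = Coprime.sym (coprime-+* q s⊥b)
  B⊥h : Coprime B (gcd c b)
  B⊥h {d} (d∣B , d∣h) = h⊥q (d∣h , coprime-divisor d⊥s (∣m+n∣m⇒∣n d∣B d∣b))
    where
    d∣b = ∣-trans d∣h (gcd[m,n]∣n c b)
    d⊥s : Coprime d s
    d⊥s (e∣d , e∣s) = s⊥b (e∣s , ∣-trans e∣d d∣b)
  c⊥B : Coprime c B
  c⊥B = Coprime.sym (⊥c B⊥s B⊥h)
  split : B ≡ b ℕ.+ s % c ℕ.* q ℕ.+ c ℕ.* (s / c ℕ.* q)
  split = trans (cong (λ t → b ℕ.+ t ℕ.* q) (m≡m%n+[m/n]*n s c)) (regroup b (s % c) (s / c) c q)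
    where
    regroup : ∀ b r t c q → b ℕ.+ (r ℕ.+ t ℕ.* c) ℕ.* q ≡ b ℕ.+ r ℕ.* q ℕ.+ c ℕ.* (t ℕ.* q)
    regroup = ℕ-Solver.solve-∀

minList-∈ : ∀ {x} {xs : List ℕ} → x ∈ xs → minList xs ∈ xs
minList-∈ {xs = y ∷ ys} _ with foldr-selective ℕ.⊓-sel y ys
... | inj₁ min≡y   = here min≡y
... | inj₂ min∈ys = there min∈ys

dN-attained : ∀ {N} (p : PN N) →
              ∃ λ k → dN p ≡ c p ℕ.+ b p ℕ.+ k ℕ.* q p × Coprime (c p) (dN p)
dN-attained p =
  let k₀ , k₀<c , c⊥b+k₀q = coprime-shift (c p) (b p) (q p) (gcd≡1⇒coprime (coprim p))
      k₀∈candidates = ∈-filter⁺ coprime? (∈-upTo⁺ k₀<c) (coprime⇒gcd≡1 c⊥b+k₀q)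
      k , k∈candidates , dN≡ = ∈-map⁻ d (minList-∈ (∈-map⁺ d k₀∈candidates))
      c⊥b+kq = proj₂ (∈-filter⁻ coprime? {xs = upTo (c p)} k∈candidates)
  in k , dN≡ , subst (Coprime (c p)) (sym dN≡) (c⊥d k c⊥b+kq)
  where
  instance _ = ℕ.>-nonZero (c≥1 p)
  d = λ k → c p ℕ.+ b p ℕ.+ k ℕ.* q p
  coprime? = λ k → gcd (c p) (b p ℕ.+ k ℕ.* q p) ≟ 1
  c⊥d : ∀ k → gcd (c p) (b p ℕ.+ k ℕ.* q p) ≡ 1 → Coprime (c p) (d k)
  c⊥d k g≡1 = subst (Coprime (c p)) (sym (ℕ.+-assoc (c p) (b p) (k ℕ.* q p)))
    (Coprime.sym (Coprime.coprime-+ (Coprime.sym (gcd≡1⇒coprime g≡1))))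

pos-+-* : ∀ a x b → + (a ℕ.+ x ℕ.* b) ≡ + a + + x * + b
pos-+-* a x b = trans (ℤ.pos-+ a (x ℕ.* b)) (cong (_+_ (+ a)) (ℤ.pos-* x b))

1+yn≡xm⇒xm-yn≡1 : ∀ x y m n → 1 ℕ.+ y ℕ.* n ≡ x ℕ.* m → + x * + m + - + y * + n ≡ 1ℤ
1+yn≡xm⇒xm-yn≡1 x y m n 1+yn≡xm = begin
  + x * + m + - + y * + n            ≡⟨ cong (_+ - + y * + n) (ℤ.pos-* x m) ⟨
  + (x ℕ.* m) + - + y * + n          ≡⟨ cong (λ t → + t + - + y * + n) 1+yn≡xm ⟨
  + (1 ℕ.+ y ℕ.* n) + - + y * + n    ≡⟨ cong (_+ - + y * + n) (pos-+-* 1 y n) ⟩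
  1ℤ + + y * + n + - + y * + n       ≡⟨ cancel 1ℤ (+ y) (+ n) ⟩
  1ℤ                                 ∎
  where
  cancel : ∀ a y n → a + y * n + - y * n ≡ a
  cancel = solve-∀

ℕ-coprime⇒bézout : ∀ {m n} → Coprime m n → ∃₂ λ u v → u * + m + v * + n ≡ 1ℤ
ℕ-coprime⇒bézout {m} {n} m⊥n with coprime-Bézout m⊥n
... | Bézout.+- x y 1+yn≡xm = + x , - + y , 1+yn≡xm⇒xm-yn≡1 x y m n 1+yn≡xm
... | Bézout.-+ x y 1+xm≡yn = - + x , + y ,
  trans (ℤ.+-comm (- + x * + m) (+ y * + n)) (1+yn≡xm⇒xm-yn≡1 y x n m 1+xm≡yn)

coprime⇒bézout : ∀ {a b} → ℤ.Coprime a b → ∃₂ λ u v → u * a + v * b ≡ 1ℤ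
coprime⇒bézout {a} {b} a⊥b with ℕ-coprime⇒bézout a⊥b | Signed.m∣∣m∣ {a} | Signed.m∣∣m∣ {b}
... | u , v , bézout | Signed.divides s ∣a∣≡sa | Signed.divides t ∣b∣≡tb = u * s , v * t ,
  trans (reassoc u s a v t b) (trans (cong₂ (λ a′ b′ → u * a′ + v * b′) (sym ∣a∣≡sa) (sym ∣b∣≡tb)) bézout)
  where
  reassoc : ∀ u s a v t b → u * s * a + v * t * b ≡ u * (s * a) + v * (t * b)
  reassoc = solve-∀

solve-congruence : ∀ {c n} .{{_ : NonZero n}} → Coprime c n → ∀ b →
                   ∃₂ λ b′ w → b′ < n × + b ≡ + c * + b′ + w * + n
solve-congruence {c} {n} c⊥n b with u , v , uc+vn≡1 ← ℕ-coprime⇒bézout c⊥n =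
  bu %ℕ n , + b * v + + c * (bu /ℕ n) , n%ℕd<d bu n , (begin
    + b                                          ≡⟨ ℤ.*-identityʳ (+ b) ⟨
    + b * 1ℤ                                     ≡⟨ cong (+ b *_) uc+vn≡1 ⟨
    + b * (u * + c + v * + n)                    ≡⟨ distribute (+ b) u (+ c) v (+ n) ⟩
    + c * bu + + b * v * + n                     ≡⟨ cong (λ t → + c * t + + b * v * + n) (a≡a%ℕn+[a/ℕn]*n bu n) ⟩
    + c * (+ (bu %ℕ n) + (bu /ℕ n) * + n) + + b * v * + n ≡⟨ regroup (+ c) (+ (bu %ℕ n)) (bu /ℕ n) (+ n) (+ b * v) ⟩
    + c * + (bu %ℕ n) + (+ b * v + + c * (bu /ℕ n)) * + n ∎)
  where
  bu = + b * u
  distribute : ∀ b u c v n → b * (u * c + v * n) ≡ c * (b * u) + b * v * n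
  distribute = solve-∀
  regroup : ∀ c r t n s → c * (r + t * n) + s * n ≡ c * r + (s + c * t) * n
  regroup = solve-∀

c*q≡n*m⇒n/gcd[c,n]∣q : ∀ c n {q m} .{{_ : NonZero (gcd c n)}} → c ℕ.* q ≡ n ℕ.* m → n / gcd c n ∣ q
c*q≡n*m⇒n/gcd[c,n]∣q c n {q} {m} cq≡nm =
  coprime-divisor (Coprime.sym (coprime-/gcd c n)) (divides m (ℕ.*-cancelʳ-≡ _ _ g (begin
    c / g ℕ.* q ℕ.* g   ≡⟨ swap₂₃ (c / g) q g ⟩
    c / g ℕ.* g ℕ.* q   ≡⟨ cong (ℕ._* q) (m/n*n≡m (gcd[m,n]∣m c n)) ⟩
    c ℕ.* q             ≡⟨ cq≡nm ⟩
    n ℕ.* m             ≡⟨ cong (ℕ._* m) (m/n*n≡m (gcd[m,n]∣n c n)) ⟨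
    n / g ℕ.* g ℕ.* m   ≡⟨ rotate (n / g) g m ⟩
    m ℕ.* (n / g) ℕ.* g ∎)))
  where
  g = gcd c n
  swap₂₃ : ∀ x y z → x ℕ.* y ℕ.* z ≡ x ℕ.* z ℕ.* y
  swap₂₃ = ℕ-Solver.solve-∀
  rotate : ∀ x y z → x ℕ.* y ℕ.* z ≡ z ℕ.* x ℕ.* y
  rotate = ℕ-Solver.solve-∀

-- a ≡ b [mod N ] unfolds to N ∣ ∣ a - b ∣, from which a and b cannot be inferred;
-- they are therefore often passed explicitly below.
≡-mod-intro : ∀ {N a b} e → a - b ≡ e * + N → a ≡ b [mod N ]
≡-mod-intro e eq = Signed.∣⇒∣ᵤ (Signed.divides e eq)

≡-mod-trans : ∀ {N a b c} → a ≡ b [mod N ] → b ≡ c [mod N ] → a ≡ c [mod N ]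
≡-mod-trans {N} {a} {b} {c} a≡b b≡c =
  Signed.∣⇒∣ᵤ (subst (+ N ∣ℤ_) (telescope a b c)
    (Signed.∣m∣n⇒∣m+n (Signed.∣ᵤ⇒∣ {+ N} {a - b} a≡b) (Signed.∣ᵤ⇒∣ {+ N} {b - c} b≡c)))
  where
  telescope : ∀ a b c → a - b + (b - c) ≡ a - c
  telescope = solve-∀

≡-mod-*ˡ : ∀ {N a b} k → a ≡ b [mod N ] → (k * a) ≡ k * b [mod N ]
≡-mod-*ˡ {N} {a} {b} k a≡b =
  Signed.∣⇒∣ᵤ (subst (+ N ∣ℤ_) (distrib k a b) (Signed.∣n⇒∣m*n k (Signed.∣ᵤ⇒∣ {+ N} {a - b} a≡b)))
  where
  distrib : ∀ k a b → k * (a - b) ≡ k * a - k * b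
  distrib = solve-∀

≡-mod-reduce : ∀ {a b} n m → a ≡ b [mod n ℕ.* m ] → a ≡ b [mod n ]
≡-mod-reduce n m = ∣-trans (m∣m*n m)

∣-≡-mod : ∀ {d N a b} → d ∣ℤ + N → d ∣ℤ b → a ≡ b [mod N ] → d ∣ℤ a
∣-≡-mod {d} {N} {a} {b} d∣N d∣b a≡b =
  subst (d ∣ℤ_) (cancel a b) (Signed.∣m∣n⇒∣m+n (Signed.∣-trans d∣N (Signed.∣ᵤ⇒∣ {+ N} {a - b} a≡b)) d∣b)
  where
  cancel : ∀ a b → a - b + b ≡ a
  cancel = solve-∀

∼-trans : ∀ {N P Q R} → P ∼[ N ] Q → Q ∼[ N ] R → P ∼[ N ] R
∼-trans {N} {x , y} {x′ , y′} {x″ , y″} (k , k⊥N , x′≡kx , y′≡ky) (k′ , k′⊥N , x″≡k′x′ , y″≡k′y′) =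
  k′ * k , k′k⊥N , compose {x} {x′} {x″} x″≡k′x′ x′≡kx , compose {y} {y′} {y″} y″≡k′y′ y′≡ky
  where
  k′k⊥N : gcd ∣ k′ * k ∣ N ≡ 1
  k′k⊥N = coprime⇒gcd≡1 (subst (λ t → Coprime t N) (sym (ℤ.abs-* k′ k))
    (Coprime.sym (coprime-*ʳ (Coprime.sym (gcd≡1⇒coprime {∣ k′ ∣} k′⊥N)) (Coprime.sym (gcd≡1⇒coprime {∣ k ∣} k⊥N)))))
  compose : ∀ {z z′ z″} → z″ ≡ k′ * z′ [mod N ] → z′ ≡ k * z [mod N ] → z″ ≡ k′ * k * z [mod N ]
  compose {z} {z′} {z″} z″≡k′z′ z′≡kz = subst (λ t → z″ ≡ t [mod N ]) (sym (ℤ.*-assoc k′ k z))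
    (≡-mod-trans {N} {z″} z″≡k′z′ (≡-mod-*ˡ {N} {z′} k′ z′≡kz))

∼-reduce : ∀ {P Q} n m → P ∼[ n ℕ.* m ] Q → P ∼[ n ] Q
∼-reduce {Q = x′ , y′} n m (k , k⊥nm , x′≡kx , y′≡ky) =
  k , coprime⇒gcd≡1 (coprime-∣ʳ (m∣m*n m) (gcd≡1⇒coprime {∣ k ∣} k⊥nm)) ,
  ≡-mod-reduce {x′} n m x′≡kx , ≡-mod-reduce {y′} n m y′≡ky

scalar-unit : ∀ {N k x y x′ y′} → ℤ.Coprime x′ y′ →
              x′ ≡ k * x [mod N ] → y′ ≡ k * y [mod N ] → gcd ∣ k ∣ N ≡ 1
scalar-unit {N} {k} {x′ = x′} {y′ = y′} x′⊥y′ x′≡kx y′≡ky =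
  coprime⇒gcd≡1 λ (d∣k , d∣N) →
    x′⊥y′ (divides-scaled {z′ = x′} d∣k d∣N x′≡kx , divides-scaled {z′ = y′} d∣k d∣N y′≡ky)
  where
  divides-scaled : ∀ {d z z′} → d ∣ ∣ k ∣ → d ∣ N → z′ ≡ k * z [mod N ] → d ∣ ∣ z′ ∣
  divides-scaled {d} {z} {z′} d∣k d∣N z′≡kz = Signed.∣⇒∣ᵤ {+ d} {z′}
    (∣-≡-mod {b = k * z} (Signed.∣ᵤ⇒∣ {+ d} {+ N} d∣N) (Signed.∣m⇒∣m*n z (Signed.∣ᵤ⇒∣ {+ d} {k} d∣k)) z′≡kz)

cross≡⇒∼ : ∀ {N x y x′ y′} → ℤ.Coprime x y → ℤ.Coprime x′ y′ →
           (x′ * y) ≡ y′ * x [mod N ] → (x , y) ∼[ N ] (x′ , y′)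
cross≡⇒∼ {N} {x} {y} {x′} {y′} x⊥y x′⊥y′ cross
  with u , v , ux+vy≡1 ← coprime⇒bézout {x} {y} x⊥y
     | Signed.divides e x′y-y′x≡eN ← Signed.∣ᵤ⇒∣ {+ N} {x′ * y - y′ * x} cross
  = k , scalar-unit {N} {k} {x} {y} {x′} {y′} x′⊥y′ x′≡kx y′≡ky , x′≡kx , y′≡ky
  where
  k = u * x′ + v * y′
  times-one : ∀ z → z ≡ z * (u * x + v * y)
  times-one z = trans (sym (ℤ.*-identityʳ z)) (cong (z *_) (sym ux+vy≡1))
  x′≡kx : x′ ≡ k * x [mod N ]
  x′≡kx = ≡-mod-intro {N} {x′} (v * e) (begin
    x′ - k * x                            ≡⟨ cong (_- k * x) (times-one x′) ⟩
    x′ * (u * x + v * y) - k * x          ≡⟨ expand u v x y x′ y′ ⟩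
    v * (x′ * y - y′ * x)                 ≡⟨ cong (v *_) x′y-y′x≡eN ⟩
    v * (e * + N)                         ≡⟨ ℤ.*-assoc v e (+ N) ⟨
    v * e * + N                           ∎)
    where
    expand : ∀ u v x y x′ y′ → x′ * (u * x + v * y) - (u * x′ + v * y′) * x ≡ v * (x′ * y - y′ * x)
    expand = solve-∀
  y′≡ky : y′ ≡ k * y [mod N ]
  y′≡ky = ≡-mod-intro {N} {y′} (- u * e) (begin
    y′ - k * y                            ≡⟨ cong (_- k * y) (times-one y′) ⟩
    y′ * (u * x + v * y) - k * y          ≡⟨ expand u v x y x′ y′ ⟩
    - u * (x′ * y - y′ * x)               ≡⟨ cong (- u *_) x′y-y′x≡eN ⟩
    - u * (e * + N)                       ≡⟨ ℤ.*-assoc (- u) e (+ N) ⟨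
    - u * e * + N                         ∎)
    where
    expand : ∀ u v x y x′ y′ → y′ * (u * x + v * y) - (u * x′ + v * y′) * y ≡ - u * (x′ * y - y′ * x)
    expand = solve-∀

topRow : M2 → Pair
topRow g = (a₁₁ g , a₁₂ g)

mat-≡ : ∀ {a b c d a′ b′ c′ d′} → a ≡ a′ → b ≡ b′ → c ≡ c′ → d ≡ d′ → mat a b c d ≡ mat a′ b′ c′ d′
mat-≡ refl refl refl refl = refl

·-assoc : ∀ F G H → (F · G) · H ≡ F · (G · H)
·-assoc (mat a b c d) (mat a′ b′ c′ d′) (mat a″ b″ c″ d″) =
  mat-≡ (entry a b a′ b′ c′ d′ a″ c″) (entry a b a′ b′ c′ d′ b″ d″)
        (entry c d a′ b′ c′ d′ a″ c″) (entry c d a′ b′ c′ d′ b″ d″)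
  where
  entry : ∀ a b a′ b′ c′ d′ x y →
          (a * a′ + b * c′) * x + (a * b′ + b * d′) * y ≡ a * (a′ * x + b′ * y) + b * (c′ * x + d′ * y)
  entry = solve-∀

0*r+1*t≡t : ∀ r t → + 0 * r + + 1 * t ≡ t
0*r+1*t≡t = solve-∀

topRow-W· : ∀ N R → topRow (W N · R) ≡ bottomRow R
topRow-W· N (mat r s t u) = cong₂ _,_ (0*r+1*t≡t r t) (0*r+1*t≡t s u)

-- γ′ keeps the top row of γ; its bottom row is forced by the bottom row -N (r s) of W_N R.
W·-factorisation : ∀ {N} (p : PN N) {R γ} → InSL2 R → bottomRow R ≡ topRow (γ · A p) →
                   Σ M2 λ γ′ → InSL2 γ′ × (W N · R ≡ γ′ · A p)
W·-factorisation (pn c q b _ refl _ _) {mat r s t u} {mat g h _ _} det≡1 refl =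
  mat g h (- (+ q * r)) (r * + b - s * + c) , trans (det-identity g h r s (+ b) (+ c) (+ q)) det≡1 ,
  trans (cong (λ N → mat (+ 0) (+ 1) (- N) (+ 0) · mat r s t u) (ℤ.pos-* c q))
        (mat-≡ (0*r+1*t≡t r t) (0*r+1*t≡t s u) (entry₂₁ g h r s (+ b) (+ c) (+ q)) (entry₂₂ g h r s (+ b) (+ c) (+ q)))
  where
  det-identity : ∀ g h r s b c q →
    g * (r * b - s * c) - h * - (q * r) ≡ r * (g * b + h * q) - s * (g * c + h * + 0)
  det-identity = solve-∀
  entry₂₁ : ∀ g h r s b c q →
    - (c * q) * r + + 0 * (g * c + h * + 0) ≡ - (q * r) * c + (r * b - s * c) * + 0
  entry₂₁ = solve-∀
  entry₂₂ : ∀ g h r s b c q →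
    - (c * q) * s + + 0 * (g * b + h * q) ≡ - (q * r) * b + (r * b - s * c) * q
  entry₂₂ = solve-∀

infix 4 _∣ᴱ_
_∣ᴱ_ : ℤ → M2 → Set
e ∣ᴱ M = e ∣ℤ a₁₁ M × e ∣ℤ a₁₂ M × e ∣ℤ a₂₁ M × e ∣ℤ a₂₂ M

∣ᴱ-·ˡ : ∀ {e} F {M} → e ∣ᴱ M → e ∣ᴱ (F · M)
∣ᴱ-·ˡ {e} (mat x y z w) {mat a b c d} (e∣a , e∣b , e∣c , e∣d) =
  combine x y e∣a e∣c , combine x y e∣b e∣d , combine z w e∣a e∣c , combine z w e∣b e∣d
  where
  combine : ∀ x y {m n} → e ∣ℤ m → e ∣ℤ n → e ∣ℤ x * m + y * n
  combine x y e∣m e∣n = Signed.∣m∣n⇒∣m+n (Signed.∣n⇒∣m*n x e∣m) (Signed.∣n⇒∣m*n y e∣n)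

gcd≡1-rightFactor : ∀ {c b q c′ b′ q′} F →
                   mat (+ c) (+ b) (+ 0) (+ q) ≡ F · mat (+ c′) (+ b′) (+ 0) (+ q′) →
                   gcd (gcd c b) q ≡ 1 → gcd (gcd c′ b′) q′ ≡ 1
gcd≡1-rightFactor {c′ = c′} {b′} {q′} F A≡FA′ cop = ∣1⇒≡1 (subst (e ∣_) cop
  (gcd-greatest (gcd-greatest (Signed.∣⇒∣ᵤ e∣c) (Signed.∣⇒∣ᵤ e∣b)) (Signed.∣⇒∣ᵤ e∣q)))
  where
  e = gcd (gcd c′ b′) q′
  e∣gcd[c′,b′] = gcd[m,n]∣m (gcd c′ b′) q′
  e∣A′ : + e ∣ᴱ mat (+ c′) (+ b′) (+ 0) (+ q′)
  e∣A′ = Signed.∣ᵤ⇒∣ (∣-trans e∣gcd[c′,b′] (gcd[m,n]∣m c′ b′)) ,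
         Signed.∣ᵤ⇒∣ (∣-trans e∣gcd[c′,b′] (gcd[m,n]∣n c′ b′)) ,
         Signed.∣ᵤ⇒∣ (e ∣0) ,
         Signed.∣ᵤ⇒∣ (gcd[m,n]∣n (gcd c′ b′) q′)
  e∣A = subst (+ e ∣ᴱ_) (sym A≡FA′) (∣ᴱ-·ˡ F e∣A′)
  e∣c = proj₁ e∣A
  e∣b = proj₁ (proj₂ e∣A)
  e∣q = proj₂ (proj₂ (proj₂ e∣A))

upper-factorisation : ∀ {c b q c′ b′ q′ x m′} w →
                      x ℕ.* c′ ≡ c → + b ≡ + x * + b′ + w * + q′ → m′ ℕ.* q′ ≡ q →
                      mat (+ c) (+ b) (+ 0) (+ q) ≡ mat (+ x) w (+ 0) (+ m′) · mat (+ c′) (+ b′) (+ 0) (+ q′)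
upper-factorisation {c′ = c′} {b′} {q′} {x} {m′} w refl b≡ refl =
  mat-≡ (trans (ℤ.pos-* x c′) (pad-right (+ x * + c′) w)) b≡
        (pad-zero (+ c′) (+ m′)) (trans (ℤ.pos-* m′ q′) (pad-left (+ b′) (+ m′ * + q′)))
  where
  pad-right : ∀ t w → t ≡ t + w * + 0
  pad-right = solve-∀
  pad-zero : ∀ c m → + 0 ≡ + 0 * c + m * + 0
  pad-zero = solve-∀
  pad-left : ∀ b t → t ≡ + 0 * b + t
  pad-left = solve-∀

_∣ᵁ_ : M2 → M2 → Set
M ∣ᵁ M′ = ∃₂ λ x y → ∃ λ z → M′ ≡ mat x y (+ 0) z · M

A-divisor : ∀ {n m} → 1 ≤ n → (p : PN (n ℕ.* m)) → Σ (PN n) λ p′ → A p′ ∣ᵁ A p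
A-divisor {n} 1≤n p@(pn c q b 1≤c cq≡nm _ cop) = divisor (solve-congruence (coprime-/gcd c n) b)
  where
  g = gcd c n
  1≤g : 1 ≤ g
  1≤g = ℕ.n≢0⇒n>0 (ℕ.≢-nonZero⁻¹ c {{ℕ.>-nonZero 1≤c}} ∘ gcd[m,n]≡0⇒m≡0)
  instance
    g-nonZero = ℕ.>-nonZero 1≤g
  n′ = n / g
  instance
    n′-nonZero = ℕ.≢-nonZero (n/gcd[m,n]≢0 c n {{ℕ.>-nonZero 1≤n}})
  gn′≡n : g ℕ.* n′ ≡ n
  gn′≡n = trans (ℕ.*-comm g n′) (m/n*n≡m (gcd[m,n]∣n c n))
  divisor : (∃₂ λ b′ w → b′ < n′ × + b ≡ + (c / g) * + b′ + w * + n′) → Σ (PN n) λ p′ → A p′ ∣ᵁ A p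
  divisor (b′ , w , b′<n′ , b≡) =
    pn g n′ b′ 1≤g gn′≡n b′<n′ (gcd≡1-rightFactor δ A≡δA′ cop) , + (c / g) , w , + (q / n′) , A≡δA′
    where
    δ = mat (+ (c / g)) w (+ 0) (+ (q / n′))
    A≡δA′ : mat (+ c) (+ b) (+ 0) (+ q) ≡ δ · mat (+ g) (+ b′) (+ 0) (+ n′)
    A≡δA′ = upper-factorisation {c′ = g} {q′ = n′} {x = c / g} {m′ = q / n′} w
              (m/n*n≡m (gcd[m,n]∣m c n)) b≡ (m/n*n≡m (c*q≡n*m⇒n/gcd[c,n]∣q c n cq≡nm))

∣ᵁ⇒pnClass-∼ : ∀ {N N′} (p : PN N) (p′ : PN N′) → A p′ ∣ᵁ A p → pnClass p′ ∼[ N′ ] pnClass p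
∣ᵁ⇒pnClass-∼ {N′ = N′} p p′ (x , y , z , A≡δA′) =
  cross≡⇒∼ {N′} {+ c p′} {+ dN p′} {+ c p} {+ dN p} c′⊥D′ c⊥D
    (≡-mod-intro {N′} {+ c p * + dN p′} e (trans
      (cross-identity (cong a₁₁ A≡δA′) (cong a₁₂ A≡δA′) (cong a₂₂ A≡δA′) 
                      (embed (c p) (b p) k (q p) D≡) (embed (c p′) (b p′) k′ (q p′) D′≡))
      (cong (e *_) (trans (sym (ℤ.pos-* (c p′) (q p′))) (cong +_ (cq≡N p′))))))
  where
  k = proj₁ (dN-attained p)
  D≡ = proj₁ (proj₂ (dN-attained p))
  c⊥D = proj₂ (proj₂ (dN-attained p))
  k′ = proj₁ (dN-attained p′)
  D′≡ = proj₁ (proj₂ (dN-attained p′))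
  c′⊥D′ = proj₂ (proj₂ (dN-attained p′))
  e = x * + k′ - y - + k * z
  embed : ∀ {D} c b k q → D ≡ c ℕ.+ b ℕ.+ k ℕ.* q → + D ≡ + c + + b + + k * + q
  embed c b k q refl = trans (pos-+-* (c ℕ.+ b) k q) (cong (_+ + k * + q) (ℤ.pos-+ c b))
  cross-identity : ∀ {C B Q D D′} →
    C ≡ x * + c p′ + y * + 0 → B ≡ x * + b p′ + y * + q p′ → Q ≡ + 0 * + b p′ + z * + q p′ →
    D ≡ C + B + + k * Q → D′ ≡ + c p′ + + b p′ + + k′ * + q p′ →
    C * D′ - D * + c p′ ≡ e * (+ c p′ * + q p′)
  cross-identity refl refl refl refl refl = identity x y z (+ c p′) (+ b p′) (+ q p′) (+ k) (+ k′)
    where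
    identity : ∀ x y z c′ b′ q′ k k′ →
      (x * c′ + y * + 0) * (c′ + b′ + k′ * q′)
        - ((x * c′ + y * + 0) + (x * b′ + y * q′) + k * (+ 0 * b′ + z * q′)) * c′
      ≡ (x * k′ - y - k * z) * (c′ * q′)
    identity = solve-∀

lemma4p8 : (n m : ℕ) → 1 ≤ n → 1 ≤ m →
           (i : Pair) → InI (n ℕ.* m) i →
           (l : Pair) → Hgraph (n ℕ.* m) i l →
           Hgraph n i l
lemma4p8 n m 1≤n _ i _ l (R , R∈SL , R∼i , p , p∼l , γ , _ , WR≡γA) = reduce (A-divisor 1≤n p)
  where
  reduce : Σ (PN n) (λ p′ → A p′ ∣ᵁ A p) → Hgraph n i l
  reduce (p′ , p′∣p@(x , y , z , A≡δA′)) =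
    R , R∈SL , ∼-reduce {bottomRow R} {i} n m R∼i ,
    p′ , ∼-trans {n} {pnClass p′} {pnClass p} {l} (∣ᵁ⇒pnClass-∼ p p′ p′∣p)
                                                 (∼-reduce {pnClass p} {l} n m p∼l) ,
    W·-factorisation p′ {R} {γ · δ} R∈SL (begin
      bottomRow R               ≡⟨ topRow-W· (n ℕ.* m) R ⟨
      topRow (W (n ℕ.* m) · R)  ≡⟨ cong topRow WR≡γA ⟩
      topRow (γ · A p)          ≡⟨ cong (λ M → topRow (γ · M)) A≡δA′ ⟩
      topRow (γ · (δ · A p′))   ≡⟨ cong topRow (·-assoc γ δ (A p′)) ⟨
      topRow ((γ · δ) · A p′)   ∎)
    where
    δ = mat x y (+ 0) z
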